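{- Let $k,n$ be positive integers with $k\le n<2k$. Then the game Nim$_{n,=k}$ is strongly miserable.
   Context: Nim$_{n,=k}$ (Exact $k$-Nim): positions are $n$-tuples of non-negative integers; a move chooses exactly $k$ distinct piles and strictly decreases each of them (each to any smaller non-negative value); in particular a position with fewer than $k$ non-empty piles is terminal. $\operatorname{mex}(S)$ is the least non-negative integer not in $S$; the normal Sprague–Grundy function is $\mathcal{G}(x)=\operatorname{mex}\{\mathcal{G}(y): x\to y\}$ (so $0$ on terminal positions); the misère function $\mathcal{G}^-$ satisfies $\mathcal{G}^-(x)=1$ for terminal $x$ and $\mathcal{G}^-(x)=\operatorname{mex}\{\mathcal{G}^-(y): x\to y\}$ otherwise. $V_{i,j}$ is the set of positions with $\mathcal{G}=i$, $\mathcal{G}^-=j$. A game is strongly miserable if every position $x$ either lies in $V_{0,1}\cup V_{1,0}$ or has a move to a position of $V_{0,1}$ and a move to a position of $V_{1,0}$. -}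

module Defs where

open import Data.Nat using (ℕ; _<_)
open import Data.Fin using (Fin)
open import Data.Fin.Subset using (Subset; _∈_; _∉_; ∣_∣)
open import Data.Product using (Σ; ∃; _×_)
open import Data.Sum using (_⊎_)
open import Relation.Nullary using (¬_)
open import Relation.Binary.PropositionalEquality using (_≡_)

Position : ℕ → Set
Position n = Fin n → ℕ

Move : (n k : ℕ) → Position n → Position n → Set
Move n k x y =
  Σ (Subset n) λ S →
    (∣ S ∣ ≡ k)
    × (∀ i → i ∈ S → y i < x i)
    × (∀ i → i ∉ S → y i ≡ x i)

Terminal : (n k : ℕ) → Position n → Set
Terminal n k x = ¬ (∃ λ y → Move n k x y)

IsMex : (ℕ → Set) → ℕ → Set
IsMex P m = ¬ P m × (∀ j → j < m → P j)

OptionValues : (n k : ℕ) → (Position n → ℕ) → Position n → ℕ → Set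
OptionValues n k f x v = ∃ λ y → Move n k x y × f y ≡ v

IsGrundy : (n k : ℕ) → (Position n → ℕ) → Set
IsGrundy n k g = ∀ x → IsMex (OptionValues n k g x) (g x)

IsMisereGrundy : (n k : ℕ) → (Position n → ℕ) → Set
IsMisereGrundy n k g⁻ =
  ∀ x → (Terminal n k x → g⁻ x ≡ 1)
      × (¬ Terminal n k x → IsMex (OptionValues n k g⁻ x) (g⁻ x))

V : (n : ℕ) → (Position n → ℕ) → (Position n → ℕ) → ℕ → ℕ → Position n → Set
V n g g⁻ i j x = (g x ≡ i) × (g⁻ x ≡ j)

StronglyMiserable : (n k : ℕ) → (Position n → ℕ) → (Position n → ℕ) → Set
StronglyMiserable n k g g⁻ =
  ∀ x → V n g g⁻ 0 1 x
      ⊎ V n g g⁻ 1 0 x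
      ⊎ ((∃ λ y → Move n k x y × V n g g⁻ 0 1 y)
         × (∃ λ z → Move n k x z × V n g g⁻ 1 0 z))

-- In Nim_{n,=k} with n < 2k, a move can always be replaced by the move emptying the same k piles,
-- after which at most n − k < k piles are non-empty: every non-terminal position has a terminal
-- option. In any well-founded game with this property, G = 0 forces G⁻ = 1 (a non-terminal
-- position of G-value 0 would have a terminal option, of G-value 0 too), and by induction
-- G = 1 ⟺ G⁻ = 0. Hence V_{0,1} = {G = 0} and V_{1,0} = {G = 1}, and a position with G ≥ 2 has
-- options of G-values 0 and 1 by the mex property.
module Submission where

open import Defs using (IsMex)
open import Data.Nat using (ℕ; zero; suc; _≤_; _<_; _*_; _+_; _∸_; z≤n; z<s)
open import Data.Fin using (zero; suc)
open import Data.Nat.Properties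
open import Data.Nat.Induction using (<-wellFounded)
open import Data.Fin.Subset using (Subset; _∈_; _∉_; ∣_∣; inside; outside; _⊆_; ∁)
open import Data.Fin.Subset.Properties using (_∈?_; drop-there; p⊆q⇒∣p∣≤∣q∣; ∣∁p∣≡n∸∣p∣; x∉p⇒x∈∁p)
open import Data.Vec.Base using ([]; _∷_; here; there)
open import Data.Product using (∃; _×_; _,_; proj₁; proj₂)
open import Data.Sum using (_⊎_; inj₁; inj₂; map; [_,_]′)
open import Data.Empty using (⊥-elim)
open import Function using (flip; _∘_; id)
open import Function.Bundles using (_⇔_; mk⇔; Equivalence)
open import Induction.WellFounded using (WellFounded; Acc; acc; module Subrelation)
import Relation.Binary.Construct.On as On
open import Relation.Nullary using (¬_; yes; no)
open import Relation.Nullary.Decidable using (decidable-stable)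
open import Relation.Binary.PropositionalEquality using (_≡_; _≢_; refl; sym; trans; subst; cong)
open import Algebra.Properties.CommutativeSemigroup +-commutativeSemigroup using (x∙yz≈y∙xz)

-- The notions of Defs for an arbitrary move relation; for Move n k they unfold to those of Defs.
module Game {P : Set} (_⟶_ : P → P → Set) where

  Terminal : P → Set
  Terminal x = ¬ (∃ λ y → x ⟶ y)

  OptionValues : (P → ℕ) → P → ℕ → Set
  OptionValues f x v = ∃ λ y → x ⟶ y × f y ≡ v

  IsGrundy : (P → ℕ) → Set
  IsGrundy g = ∀ x → IsMex (OptionValues g x) (g x)

  IsMisereGrundy : (P → ℕ) → Set
  IsMisereGrundy g⁻ =
    ∀ x → (Terminal x → g⁻ x ≡ 1)
        × (¬ Terminal x → IsMex (OptionValues g⁻ x) (g⁻ x))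

  V : (P → ℕ) → (P → ℕ) → ℕ → ℕ → P → Set
  V g g⁻ i j x = (g x ≡ i) × (g⁻ x ≡ j)

  StronglyMiserable : (P → ℕ) → (P → ℕ) → Set
  StronglyMiserable g g⁻ =
    ∀ x → V g g⁻ 0 1 x
        ⊎ V g g⁻ 1 0 x
        ⊎ ((∃ λ y → x ⟶ y × V g g⁻ 0 1 y)
           × (∃ λ z → x ⟶ z × V g g⁻ 1 0 z))

  TerminalInOneMove : Set
  TerminalInOneMove = ∀ {x y} → x ⟶ y → ∃ λ t → x ⟶ t × Terminal t

  module _ {g g⁻ : P → ℕ} (isG : IsGrundy g) (isM : IsMisereGrundy g⁻) where

    grundy-option : ∀ {x j} → j < g x → OptionValues g x j
    grundy-option {x} {j} = proj₂ (isG x) j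

    grundy-≢ : ∀ {x y} → x ⟶ y → g y ≢ g x
    grundy-≢ {x} {y} x⟶y e = proj₁ (isG x) (y , x⟶y , e)

    misere-option : ∀ {x j} → ¬ Terminal x → j < g⁻ x → OptionValues g⁻ x j
    misere-option {x} {j} ¬T = proj₂ (proj₂ (isM x) ¬T) j

    misere-≢ : ∀ {x y} → ¬ Terminal x → x ⟶ y → g⁻ y ≢ g⁻ x
    misere-≢ {x} {y} ¬T x⟶y e = proj₁ (proj₂ (isM x) ¬T) (y , x⟶y , e)

    misere-terminal : ∀ {x} → Terminal x → g⁻ x ≡ 1
    misere-terminal {x} = proj₁ (isM x)

    grundy-terminal : ∀ {x} → Terminal x → g x ≡ 0
    grundy-terminal T =
      n≤0⇒n≡0 (≮⇒≥ λ 0<g → let (y , x⟶y , _) = grundy-option 0<g in T (y , x⟶y))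

    module _ (terminal-in-one-move : TerminalInOneMove) where

      grundy≡0⇒misere≡1 : ∀ {x} → g x ≡ 0 → g⁻ x ≡ 1
      grundy≡0⇒misere≡1 {x} g≡0 = decidable-stable (g⁻ x ≟ 1) λ g⁻≢1 →
        let ¬T : ¬ Terminal x
            ¬T = g⁻≢1 ∘ misere-terminal
        in ¬T λ (_ , x⟶y) →
             let (t , x⟶t , Tt) = terminal-in-one-move x⟶y
             in grundy-≢ x⟶t (trans (grundy-terminal Tt) (sym g≡0))

      grundy≡1⇔misere≡0 : WellFounded (flip _⟶_) → ∀ x → (g x ≡ 1) ⇔ (g⁻ x ≡ 0)
      grundy≡1⇔misere≡0 wf x = go (wf x)
        where
        go : ∀ {x} → Acc (flip _⟶_) x → (g x ≡ 1) ⇔ (g⁻ x ≡ 0)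
        go {x} (acc rs) = mk⇔ forward backward
          where
          forward : g x ≡ 1 → g⁻ x ≡ 0
          forward g≡1 = n≤0⇒n≡0 (≮⇒≥ λ 0<g⁻ →
            let ¬T : ¬ Terminal x
                ¬T T = 1+n≢0 (trans (sym g≡1) (grundy-terminal T))
                (y , x⟶y , g⁻y≡0) = misere-option ¬T 0<g⁻
            in grundy-≢ x⟶y (trans (Equivalence.from (go (rs x⟶y)) g⁻y≡0) (sym g≡1)))

          backward : g⁻ x ≡ 0 → g x ≡ 1
          backward g⁻≡0 = [ ⊥-elim ∘ g≢0 , id ]′ (n≤1⇒n≡0∨n≡1 (≮⇒≥ g≮2))
            where
            g≢0 : g x ≢ 0
            g≢0 g≡0 = 0≢1+n (trans (sym g⁻≡0) (grundy≡0⇒misere≡1 g≡0))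
            ¬T : ¬ Terminal x
            ¬T T = 0≢1+n (trans (sym g⁻≡0) (misere-terminal T))
            g≮2 : ¬ 1 < g x
            g≮2 1<g = let (y , x⟶y , gy≡1) = grundy-option 1<g
                      in misere-≢ ¬T x⟶y (trans (Equivalence.to (go (rs x⟶y)) gy≡1) (sym g⁻≡0))

      module _ (wf : WellFounded (flip _⟶_)) where

        grundy≡0⇒V₀₁ : ∀ {x} → g x ≡ 0 → V g g⁻ 0 1 x
        grundy≡0⇒V₀₁ g≡0 = g≡0 , grundy≡0⇒misere≡1 g≡0

        grundy≡1⇒V₁₀ : ∀ {x} → g x ≡ 1 → V g g⁻ 1 0 x
        grundy≡1⇒V₁₀ {x} g≡1 = g≡1 , Equivalence.to (grundy≡1⇔misere≡0 wf x) g≡1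

        strongly-miserable : StronglyMiserable g g⁻
        strongly-miserable x with g x ≤? 1
        ... | yes g≤1 = map grundy≡0⇒V₀₁ (inj₁ ∘ grundy≡1⇒V₁₀) (n≤1⇒n≡0∨n≡1 g≤1)
        ... | no  g≰1 = inj₂ (inj₂ (option-in grundy≡0⇒V₀₁ (<-trans z<s (≰⇒> g≰1))
                                   , option-in grundy≡1⇒V₁₀ (≰⇒> g≰1)))
          where
          option-in : ∀ {j} {Q : P → Set} → (∀ {y} → g y ≡ j → Q y) → j < g x → ∃ λ y → x ⟶ y × Q y
          option-in toQ j<g = let (y , x⟶y , gy≡j) = grundy-option j<g in y , x⟶y , toQ gy≡j

open import Defs using (Position; Move; Terminal; IsGrundy; IsMisereGrundy; StronglyMiserable)

total : ∀ {n} → Position n → ℕ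
total {zero}  x = 0
total {suc n} x = x zero + total (x ∘ suc)

total-shrinks : ∀ {n} (S : Subset n) {x y : Position n} →
  (∀ i → i ∈ S → y i < x i) → (∀ i → i ∉ S → y i ≡ x i) → ∣ S ∣ + total y ≤ total x
total-shrinks [] _ _ = z≤n
total-shrinks (inside ∷ S) {x} {y} dec same = begin
  suc (∣ S ∣ + (y zero + total (y ∘ suc))) ≡⟨ cong suc (x∙yz≈y∙xz ∣ S ∣ (y zero) _) ⟩
  suc (y zero) + (∣ S ∣ + total (y ∘ suc))  ≤⟨ +-mono-≤ (dec zero here) tail-shrinks ⟩
  x zero + total (x ∘ suc)                  ∎
  where
  open ≤-Reasoning
  tail-shrinks : ∣ S ∣ + total (y ∘ suc) ≤ total (x ∘ suc)
  tail-shrinks = total-shrinks S (λ i → dec (suc i) ∘ there) (λ i → same (suc i) ∘ (_∘ drop-there))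
total-shrinks (outside ∷ S) {x} {y} dec same = begin
  ∣ S ∣ + (y zero + total (y ∘ suc)) ≡⟨ x∙yz≈y∙xz ∣ S ∣ (y zero) _ ⟩
  y zero + (∣ S ∣ + total (y ∘ suc)) ≤⟨ +-mono-≤ (≤-reflexive (same zero λ ())) tail-shrinks ⟩
  x zero + total (x ∘ suc)            ∎
  where
  open ≤-Reasoning
  tail-shrinks : ∣ S ∣ + total (y ∘ suc) ≤ total (x ∘ suc)
  tail-shrinks = total-shrinks S (λ i → dec (suc i) ∘ there) (λ i → same (suc i) ∘ (_∘ drop-there))

total-decreasing : ∀ {n k} {x y : Position n} → 1 ≤ k → Move n k x y → total y < total x
total-decreasing {y = y} 1≤k (S , ∣S∣≡k , dec , same) =
  ≤-trans (+-monoˡ-≤ (total y) (subst (1 ≤_) (sym ∣S∣≡k) 1≤k)) (total-shrinks S dec same)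

moves-wellFounded : ∀ {n k} → 1 ≤ k → WellFounded (flip (Move n k))
moves-wellFounded 1≤k =
  Subrelation.wellFounded (total-decreasing 1≤k) (On.wellFounded total <-wellFounded)

clear : ∀ {n} → Subset n → Position n → Position n
clear S x i with i ∈? S
... | yes _ = 0
... | no  _ = x i

clear-∈ : ∀ {n} {S : Subset n} {x i} → i ∈ S → clear S x i ≡ 0
clear-∈ {S = S} {i = i} i∈S with i ∈? S
... | yes _   = refl
... | no  i∉S = ⊥-elim (i∉S i∈S)

clear-∉ : ∀ {n} {S : Subset n} {x i} → i ∉ S → clear S x i ≡ x i
clear-∉ {S = S} {i = i} i∉S with i ∈? S
... | yes i∈S = ⊥-elim (i∉S i∈S)
... | no  _   = refl

n∸k<k : ∀ {k n} → k ≤ n → n < 2 * k → n ∸ k < k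
n∸k<k {k} {n} k≤n n<2k = +-cancelˡ-< k (n ∸ k) k (begin-strict
  k + (n ∸ k) ≡⟨ m+[n∸m]≡n k≤n ⟩
  n           <⟨ n<2k ⟩
  2 * k       ≡⟨ cong (k +_) (+-identityʳ k) ⟩
  k + k       ∎)
  where open ≤-Reasoning

clear-terminal : ∀ {n k} {S : Subset n} {x} → k ≤ n → n < 2 * k → ∣ S ∣ ≡ k → Terminal n k (clear S x)
clear-terminal {n} {k} {S} {x} k≤n n<2k ∣S∣≡k (z , T , ∣T∣≡k , dec , _) =
  <⇒≱ (n∸k<k k≤n n<2k) (begin
    k         ≡⟨ sym ∣T∣≡k ⟩
    ∣ T ∣     ≤⟨ p⊆q⇒∣p∣≤∣q∣ T⊆∁S ⟩
    ∣ ∁ S ∣   ≡⟨ ∣∁p∣≡n∸∣p∣ S ⟩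
    n ∸ ∣ S ∣ ≡⟨ cong (n ∸_) ∣S∣≡k ⟩
    n ∸ k     ∎)
  where
  open ≤-Reasoning
  T⊆∁S : T ⊆ ∁ S
  T⊆∁S {i} i∈T = x∉p⇒x∈∁p λ i∈S → n≮0 (subst (z i <_) (clear-∈ i∈S) (dec i i∈T))

moves-terminalInOneMove : ∀ {n k} → k ≤ n → n < 2 * k → Game.TerminalInOneMove (Move n k)
moves-terminalInOneMove k≤n n<2k {x} (S , ∣S∣≡k , dec , _) =
  clear S x , (S , ∣S∣≡k , dec′ , λ i → clear-∉) , clear-terminal k≤n n<2k ∣S∣≡k
  where
  dec′ : ∀ i → i ∈ S → clear S x i < x i
  dec′ i i∈S = subst (_< x i) (sym (clear-∈ i∈S)) (≤-trans z<s (dec i i∈S))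

proposition6p22 : (k n : ℕ) → 1 ≤ k → k ≤ n → n < 2 * k →
    (g g⁻ : Position n → ℕ) → IsGrundy n k g → IsMisereGrundy n k g⁻ →
    StronglyMiserable n k g g⁻
proposition6p22 k n 1≤k k≤n n<2k g g⁻ isG isM =
  Game.strongly-miserable (Move n k) isG isM (moves-terminalInOneMove k≤n n<2k) (moves-wellFounded 1≤k)
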